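{- Let $n\ge 1$ and $m\ge 1$ be integers. The graph of pattern overlaps $\vec{P}_n$ over the alphabet $[m]$ contains a Hamiltonian circuit, i.e. a directed closed walk that visits every vertex of $\vec{P}_n$ exactly once.
   Context: Let $[m]=\{1,\ldots,m\}$ with its natural order. A pattern is a nonempty word which, for some $k\ge1$, contains each of the letters $1,\ldots,k$ at least once and no other letters. The graph of pattern overlaps $\vec{P}_n$ over $[m]$ is the directed graph whose vertices are all patterns of length $n$ over $[m]$, with an arc from $u$ to $v$ if and only if $u=aw$ and $v=wb$ for some word $w$ of length $n-1$ and letters $a,b\in[m]$ (loops allowed; this is the subgraph of the de Bruijn graph on $[m]^n$ induced by the patterns). -}

module Defs where

open import Data.Nat using (ℕ; suc; _<_; _≤_)
open import Data.Nat.DivMod using (_mod_)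
open import Data.Fin using (Fin; toℕ)
open import Data.List using (List; _∷_; _++_; [_]; length)
open import Data.List.Membership.Propositional using (_∈_)
open import Data.Product using (Σ; _×_; ∃)
open import Relation.Binary.PropositionalEquality using (_≡_)
open import Function.Definitions using (Injective)

-- Letters of [m] = {1,…,m} are represented by Fin m, letter (i+1) ↔ i : Fin m,
-- so the natural order is preserved.  Words are lists of letters.
Word : ℕ → Set
Word m = List (Fin m)

IsPattern : {m : ℕ} → Word m → Set
IsPattern {m} w =
  (1 ≤ length w) ×
  Σ ℕ λ k → (1 ≤ k) ×
    ((x : Fin m) → x ∈ w → toℕ x < k) ×
    ((x : Fin m) → toℕ x < k → x ∈ w)

IsVertex : (n m : ℕ) → Word m → Set
IsVertex n m u = (length u ≡ n) × IsPattern u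

Arc : {m : ℕ} → Word m → Word m → Set
Arc {m} u v = Σ (Fin m) λ a → Σ (Fin m) λ b → Σ (Word m) λ w →
  (u ≡ a ∷ w) × (v ≡ w ++ [ b ])

next : {k : ℕ} → Fin (suc k) → Fin (suc k)
next {k} i = suc (toℕ i) mod (suc k)

HamiltonianCircuit : (n m : ℕ) → Set
HamiltonianCircuit n m =
  Σ ℕ λ k → Σ (Fin (suc k) → Word m) λ c →
    ((i : Fin (suc k)) → IsVertex n m (c i)) ×
    Injective _≡_ _≡_ c ×
    ((u : Word m) → IsVertex n m u → ∃ λ i → c i ≡ u) ×
    ((i : Fin (suc k)) → Arc (c i) (c (next i)))

{-# OPTIONS --safe #-}
module Submission where

-- Rotation permutes the letters of a word, so each vertex v lies on the cycle
-- v → rotate v → rotate² v → ⋯ → v of P⃗ₙ formed by its distinct rotations (its necklace).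
-- The words a ∷ w and 0 ∷ w have the same out-neighbours, so when they lie on two disjoint
-- cycles, exchanging their successors merges the cycles into one.  Rotating a maximal letter of
-- a pattern to the front and replacing it by 0 gives a pattern of smaller weight (sum of letters)
-- unless the weight is already 0.  So, starting from the necklace of 0ⁿ and raising the weight
-- bound one step at a time, the necklace of every new vertex can be spliced into the circuit
-- built so far; the circuit stays a union of necklaces, hence is disjoint from every necklace it
-- does not contain.

open import Defs
open import Data.Empty.Polymorphic using (⊥)
open import Data.Fin.Base as Fin using (Fin; toℕ)
open import Data.Fin.Properties using (toℕ<n; toℕ≤pred[n]; toℕ-fromℕ<; toℕ-injective; ≤-totalOrder; all?)
import Data.Fin.Properties as Finₚ
open import Data.List.Base as List
  using (List; []; _∷_; _++_; _∷ʳ_; [_]; length; applyUpTo; allFin; cartesianProductWith)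
open import Data.List.Membership.Propositional using (_∈_; _∉_)
open import Data.List.Membership.Propositional.Properties
  using (∈-∃++; ∈-applyUpTo⁻; ∈-applyUpTo⁺; ∈-lookup; ∈-++⁻; ∈-++⁺ˡ; ∈-++⁺ʳ; ∈-allFin;
         ∈-cartesianProductWith⁺)
open import Data.List.Properties
  using (≡-dec; length-++; length-replicate; ++-assoc; ++-identityʳ; ∷ʳ-injective; applyUpTo-∷ʳ)
open import Data.List.Relation.Binary.Disjoint.Propositional using (Disjoint)
open import Data.List.Relation.Binary.Permutation.Propositional
  using (_↭_; ↭-sym; ↭-trans; ↭-refl; prep; ↭⇒↭ₛ)
open import Data.List.Relation.Binary.Permutation.Propositional.Properties
  using (++-comm; ∷↭∷ʳ; ++⁺; shift; ↭-length; ∈-resp-↭; All-resp-↭; map⁺)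
import Data.List.Relation.Binary.Permutation.Setoid.Properties as Permutationₛ
open import Data.List.Relation.Binary.Subset.Propositional using (_⊆_)
open import Data.List.Relation.Unary.All as All using (All; []; _∷_)
import Data.List.Relation.Unary.All.Properties as Allₚ
open import Data.List.Relation.Unary.AllPairs using (_∷_)
open import Data.List.Relation.Unary.Any as Any using (here; there)
open import Data.List.Relation.Unary.Any.Properties using (lookup-index)
open import Data.List.Relation.Unary.Linked using (Linked; []; [-]; _∷_)
import Data.List.Relation.Unary.Linked.Properties as Linkedₚ
open import Data.List.Relation.Unary.Unique.Propositional using (Unique)
import Data.List.Relation.Unary.Unique.Propositional.Properties as Uniqueₚ
open import Data.Nat.Base using (ℕ; zero; suc; _+_; _*_; _∸_; _≤_; _<_; z≤n; s≤s)
open import Data.Nat.DivMod using (_%_; m<n⇒m%n≡m; n%n≡0)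
open import Data.Nat.GeneralisedArithmetic using (iterate)
open import Data.Nat.Induction using (<-rec)
open import Data.Nat.ListAction using (sum)
open import Data.Nat.ListAction.Properties using (sum-↭)
open import Data.Nat.Properties
  using (_≟_; _≤?_; anyUpTo?; suc-injective; +-comm; +-suc; *-zeroʳ; +-mono-≤; ≤-reflexive; ≤-trans;
         ≤-<-trans; <-trans; ≤-pred; <⇒≤; <⇒≢; ≤∧≢⇒<; m≤n⇒m<n∨m≡n; m≤n⇒∃[o]m+o≡n; m+[n∸m]≡n;
         m≤n+m; m<m+n; n≤0⇒n≡0)
open import Data.Product using (Σ; ∃; _×_; _,_; proj₁)
open import Data.Sum using (_⊎_; inj₁; inj₂; [_,_]′)
open import Function using (_∘_; id)
open import Function.Definitions using (Injective)
open import Level using (Level)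
open import Relation.Binary.Core using (Rel)
open import Relation.Binary.PropositionalEquality
  using (_≡_; _≢_; refl; sym; trans; cong; subst; setoid; module ≡-Reasoning)
open import Relation.Nullary using (¬_; yes; no; contradiction)
open import Relation.Nullary.Decidable as Dec using (_×-dec_; _→-dec_)
open import Relation.Unary using (Pred; Decidable)

private
  variable
    a ℓ p : Level
    A : Set a

module _ {P : Pred ℕ p} (P? : Decidable P) where

  LeastWitness : Set p
  LeastWitness = ∃ λ i → P i × (∀ {j} → j < i → ¬ P j)

  least-witness : ∀ {k} → P k → LeastWitness
  least-witness {k} = <-rec (λ k → P k → LeastWitness) search k
    where
    search : ∀ k → (∀ {j} → j < k → P j → LeastWitness) → P k → LeastWitness
    search k smaller Pk with anyUpTo? P? k
    ... | yes (j , j<k , Pj) = smaller j<k Pj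
    ... | no none            = k , Pk , λ j<k Pj → none (_ , j<k , Pj)

module _ (f : A → A) where

  iterate-+ : ∀ x i j → iterate f x (i + j) ≡ iterate f (iterate f x i) j
  iterate-+ x zero    j = refl
  iterate-+ x (suc i) j = iterate-+ (f x) i j

  iterate-suc : ∀ x k → iterate f x (suc k) ≡ f (iterate f x k)
  iterate-suc x zero    = refl
  iterate-suc x (suc k) = iterate-suc (f x) k

  iterate-injective : Injective _≡_ _≡_ f → ∀ k → Injective _≡_ _≡_ (λ x → iterate f x k)
  iterate-injective f-injective zero    eq = eq
  iterate-injective f-injective (suc k) eq = f-injective (iterate-injective f-injective k eq)

  iterate-closed : ∀ {xs : List A} → (∀ {u} → u ∈ xs → f u ∈ xs) → ∀ {x} k → x ∈ xs → iterate f x k ∈ xs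
  iterate-closed closed zero    x∈xs = x∈xs
  iterate-closed closed (suc k) x∈xs = iterate-closed closed k (closed x∈xs)

rotate : List A → List A
rotate []       = []
rotate (x ∷ xs) = xs ∷ʳ x

rotate-↭ : (xs : List A) → rotate xs ↭ xs
rotate-↭ []       = ↭-refl
rotate-↭ (x ∷ xs) = ↭-sym (∷↭∷ʳ x xs)

rotate-injective : Injective _≡_ _≡_ (rotate {A = A})
rotate-injective {x = []}        {[]}        eq = refl
rotate-injective {x = x ∷ xs}    {y ∷ ys}    eq with refl , refl ← ∷ʳ-injective xs ys eq = refl
rotate-injective {x = []}        {_ ∷ []}    ()
rotate-injective {x = []}        {_ ∷ _ ∷ _} ()
rotate-injective {x = _ ∷ []}    {[]}        ()
rotate-injective {x = _ ∷ _ ∷ _} {[]}        ()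

iterate-rotate-↭ : ∀ k (xs : List A) → iterate rotate xs k ↭ xs
iterate-rotate-↭ zero    xs = ↭-refl
iterate-rotate-↭ (suc k) xs = ↭-trans (iterate-rotate-↭ k (rotate xs)) (rotate-↭ xs)

iterate-rotate-++ : (xs ys : List A) → iterate rotate (xs ++ ys) (length xs) ≡ ys ++ xs
iterate-rotate-++ []       ys = sym (++-identityʳ ys)
iterate-rotate-++ (x ∷ xs) ys = begin
  iterate rotate ((xs ++ ys) ∷ʳ x) (length xs) ≡⟨ cong (λ zs → iterate rotate zs (length xs))
                                                       (++-assoc xs ys [ x ]) ⟩
  iterate rotate (xs ++ ys ∷ʳ x) (length xs)   ≡⟨ iterate-rotate-++ xs (ys ∷ʳ x) ⟩
  (ys ∷ʳ x) ++ xs                              ≡⟨ ++-assoc ys [ x ] xs ⟩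
  ys ++ x ∷ xs                                 ∎
  where open ≡-Reasoning

iterate-rotate-length : (xs : List A) → iterate rotate xs (length xs) ≡ xs
iterate-rotate-length xs = begin
  iterate rotate xs (length xs)         ≡⟨ cong (λ zs → iterate rotate zs (length xs)) (++-identityʳ xs) ⟨
  iterate rotate (xs ++ []) (length xs) ≡⟨ iterate-rotate-++ xs [] ⟩
  xs                                    ∎
  where open ≡-Reasoning

rotate-to-head : ∀ {x} {xs : List A} → x ∈ xs → ∃ λ i → i < length xs × ∃ λ ys → iterate rotate xs i ≡ x ∷ ys
rotate-to-head x∈xs with ps , qs , refl ← ∈-∃++ x∈xs =
  length ps , subst (length ps <_) (sym (length-++ ps)) (m<m+n (length ps) (s≤s z≤n)) ,
  qs ++ ps , iterate-rotate-++ ps (_ ∷ qs)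

next-cases : ∀ {k} (i : Fin (suc k)) → toℕ (next i) ≡ suc (toℕ i) ⊎ (toℕ i ≡ k × next i ≡ Fin.zero)
next-cases {k} i with m≤n⇒m<n∨m≡n (toℕ<n i)
... | inj₁ 1+i<1+k = inj₁ (trans (toℕ-fromℕ< _) (m<n⇒m%n≡m 1+i<1+k))
... | inj₂ 1+i≡1+k = inj₂ (suc-injective 1+i≡1+k , toℕ-injective (trans (toℕ-fromℕ< _) wraps))
  where
  wraps : suc (toℕ i) % suc k ≡ 0
  wraps = trans (cong (_% suc k) 1+i≡1+k) (n%n≡0 (suc k))

module _ {E : Rel A ℓ} where

  Linked-join : ∀ xs {y ys} → Linked E (xs ∷ʳ y) → Linked E (y ∷ ys) → Linked E (xs ++ y ∷ ys)
  Linked-join []            _        l = l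
  Linked-join (x ∷ [])      (e ∷ _)  l = e ∷ l
  Linked-join (x ∷ x′ ∷ xs) (e ∷ l′) l = e ∷ Linked-join (x′ ∷ xs) l′ l

  Linked-++⁻ˡ : ∀ xs {ys} → Linked E (xs ++ ys) → Linked E xs
  Linked-++⁻ˡ []           _       = []
  Linked-++⁻ˡ (x ∷ [])     _       = [-]
  Linked-++⁻ˡ (x ∷ y ∷ xs) (e ∷ l) = e ∷ Linked-++⁻ˡ (y ∷ xs) l

  Linked-replaceHead : ∀ {x x′ xs} → (∀ {y} → E x y → E x′ y) → Linked E (x ∷ xs) → Linked E (x′ ∷ xs)
  Linked-replaceHead twin [-]     = [-]
  Linked-replaceHead twin (e ∷ l) = twin e ∷ l

  Linked-lookup : ∀ {xs} → Linked E xs → ∀ i j → toℕ j ≡ suc (toℕ i) → E (List.lookup xs i) (List.lookup xs j)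
  Linked-lookup (e ∷ _) Fin.zero    (Fin.suc Fin.zero) refl = e
  Linked-lookup (_ ∷ l) (Fin.suc i) (Fin.suc j)        eq   = Linked-lookup l i j (suc-injective eq)

  Linked-lookup-last : ∀ xs {y} → Linked E (xs ∷ʳ y) → ∀ i → suc (toℕ i) ≡ length xs → E (List.lookup xs i) y
  Linked-lookup-last (x ∷ [])      (e ∷ _) Fin.zero    refl = e
  Linked-lookup-last (x ∷ x′ ∷ xs) (_ ∷ l) (Fin.suc i) eq   =
    Linked-lookup-last (x′ ∷ xs) l i (suc-injective eq)

  Closed : List A → Set _
  Closed []       = ⊥
  Closed (x ∷ xs) = Linked E (x ∷ xs ∷ʳ x)

  Closed-rotate : ∀ xs → Closed xs → Closed (rotate xs)
  Closed-rotate (x ∷ [])     c       = c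
  Closed-rotate (x ∷ y ∷ ys) (e ∷ c) =
    subst (Linked E) (cong (y ∷_) (sym (++-assoc ys [ x ] [ y ]))) (Linked-join (y ∷ ys) c (e ∷ [-]))

  Closed-iterate-rotate : ∀ k xs → Closed xs → Closed (iterate rotate xs k)
  Closed-iterate-rotate zero    xs c = c
  Closed-iterate-rotate (suc k) xs c = Closed-iterate-rotate k (rotate xs) (Closed-rotate xs c)

  Closed-reanchor : ∀ {x xs} → x ∈ xs → Closed xs → ∃ λ ys → Closed (x ∷ ys) × x ∷ ys ↭ xs
  Closed-reanchor {x} x∈xs c with ys , zs , refl ← ∈-∃++ x∈xs =
    zs ++ ys ,
    subst Closed (iterate-rotate-++ ys (x ∷ zs)) (Closed-iterate-rotate (length ys) _ c) ,
    ++-comm (x ∷ zs) ys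

  Closed-splice : ∀ {x x′ xs xs′} → (∀ {y} → E x y → E x′ y) → (∀ {y} → E x′ y → E x y) →
                  Closed (x ∷ xs) → Closed (x′ ∷ xs′) → Closed (x ∷ xs′ ++ x′ ∷ xs)
  Closed-splice {x} {x′} {xs} {xs′} to from c c′ =
    subst (Linked E) (cong (x ∷_) (sym (++-assoc xs′ (x′ ∷ xs) [ x ])))
      (Linked-join (x ∷ xs′) (Linked-replaceHead from c′) (Linked-replaceHead to c))

  Closed-merge : ∀ {x x′ xs xs′} → (∀ {y} → E x y → E x′ y) → (∀ {y} → E x′ y → E x y) →
                 x ∈ xs → x′ ∈ xs′ → Closed xs → Closed xs′ → ∃ λ ys → Closed ys × ys ↭ xs ++ xs′
  Closed-merge {x} {x′} to from x∈xs x′∈xs′ c c′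
    with ys , d , ys↭ ← Closed-reanchor x∈xs c | ys′ , d′ , ys′↭ ← Closed-reanchor x′∈xs′ c′ =
    x ∷ ys′ ++ x′ ∷ ys , Closed-splice to from d d′ ,
    ↭-trans (prep x (↭-trans (++-comm ys′ (x′ ∷ ys)) (↭-sym (shift x′ ys ys′)))) (++⁺ ys↭ ys′↭)

  Closed-lookup-next : ∀ x xs → Closed (x ∷ xs) → ∀ i →
                       E (List.lookup (x ∷ xs) i) (List.lookup (x ∷ xs) (next i))
  Closed-lookup-next x xs c i with next-cases i
  ... | inj₁ step                         = Linked-lookup (Linked-++⁻ˡ (x ∷ xs) c) i (next i) step
  ... | inj₂ (last , wraps) rewrite wraps = Linked-lookup-last (x ∷ xs) c i (cong suc last)

Unique-lookup-injective : ∀ {xs : List A} → Unique xs → Injective _≡_ _≡_ (List.lookup xs)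
Unique-lookup-injective (_ ∷ _)  {Fin.zero}  {Fin.zero}  _  = refl
Unique-lookup-injective (x∉ ∷ _) {Fin.zero}  {Fin.suc j} eq = contradiction eq (All.lookup x∉ (∈-lookup j))
Unique-lookup-injective (x∉ ∷ _) {Fin.suc i} {Fin.zero}  eq =
  contradiction (sym eq) (All.lookup x∉ (∈-lookup i))
Unique-lookup-injective (_ ∷ u)  {Fin.suc i} {Fin.suc j} eq = cong Fin.suc (Unique-lookup-injective u eq)

module Orbit (f : A → A) (x : A) (p : ℕ) (returns : iterate f x (suc p) ≡ x) where

  orbit : List A
  orbit = applyUpTo (iterate f x) (suc p)

  orbit-closed : ∀ {u} → u ∈ orbit → f u ∈ orbit
  orbit-closed u∈orbit with i , i<1+p , refl ← ∈-applyUpTo⁻ (iterate f x) u∈orbit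
    rewrite sym (iterate-suc f x i) with m≤n⇒m<n∨m≡n i<1+p
  ... | inj₁ 1+i<1+p = ∈-applyUpTo⁺ (iterate f x) 1+i<1+p
  ... | inj₂ refl    = subst (_∈ orbit) (sym returns) (here refl)

  orbit-returns : ∀ {u} → u ∈ orbit → ∃ λ j → iterate f u j ≡ x
  orbit-returns u∈orbit with i , i<1+p , refl ← ∈-applyUpTo⁻ (iterate f x) u∈orbit =
    suc p ∸ i , trans (sym (iterate-+ f x i (suc p ∸ i)))
                      (trans (cong (iterate f x) (m+[n∸m]≡n (<⇒≤ i<1+p))) returns)

  orbit-unique : Injective _≡_ _≡_ f → (∀ {j} → j < p → iterate f x (suc j) ≢ x) → Unique orbit
  orbit-unique f-injective minimal = Uniqueₚ.applyUpTo⁺₁ (iterate f x) (suc p) distinct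
    where
    distinct : ∀ {i j} → i < j → j < suc p → iterate f x i ≢ iterate f x j
    distinct {i} i<j j<1+p eq with o , refl ← m≤n⇒∃[o]m+o≡n i<j =
      minimal (≤-<-trans (m≤n+m o i) (≤-pred j<1+p)) (sym (iterate-injective f f-injective i (begin
        iterate f x i                     ≡⟨ eq ⟩
        iterate f x (suc i + o)           ≡⟨ cong (iterate f x) (trans (sym (+-suc i o)) (+-comm i (suc o))) ⟩
        iterate f x (suc o + i)           ≡⟨ iterate-+ f x (suc o) i ⟩
        iterate f (iterate f x (suc o)) i ∎)))
      where open ≡-Reasoning

  orbit-Closed : ∀ {E : Rel A ℓ} → (∀ i → E (iterate f x i) (f (iterate f x i))) → Closed {E = E} orbit
  orbit-Closed {E = E} step = subst (Linked E) (begin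
      applyUpTo (iterate f x) (suc (suc p)) ≡⟨ applyUpTo-∷ʳ (iterate f x) (suc p) ⟨
      orbit ∷ʳ iterate f x (suc p)          ≡⟨ cong (orbit ∷ʳ_) returns ⟩
      orbit ∷ʳ x                            ∎)
    (Linkedₚ.applyUpTo⁺₂ (iterate f x) (suc (suc p)) λ i → subst (E _) (sym (iterate-suc f x i)) (step i))
    where open ≡-Reasoning

weight : ∀ {m} → Word m → ℕ
weight w = sum (List.map toℕ w)

weight-↭ : ∀ {m} {u u′ : Word m} → u ↭ u′ → weight u ≡ weight u′
weight-↭ u↭u′ = sum-↭ (map⁺ toℕ u↭u′)

weight-bound : ∀ {m b} {w : Word m} → All (λ x → toℕ x ≤ b) w → weight w ≤ length w * b
weight-bound []          = z≤n
weight-bound (x≤b ∷ w≤b) = +-mono-≤ x≤b (weight-bound w≤b)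

module _ {m : ℕ} where

  open import Data.List.Membership.DecPropositional (Finₚ._≟_ {m}) using (_∈?_)

  maximal-letter : (a : Fin m) (w : Word m) → ∃ λ c → c ∈ a ∷ w × All (Fin._≤ c) (a ∷ w)
  maximal-letter a w = max a w , [ here , there ]′ (argmax-sel id a w) , ⊥≤max a w ∷ xs≤max a w
    where open import Data.List.Extrema (≤-totalOrder m)

  isPattern? : Decidable (IsPattern {m})
  isPattern? []      = no λ ()
  isPattern? (a ∷ w) with c , c∈ , ≤c ← maximal-letter a w =
    Dec.map′ (λ upTo-c → s≤s z≤n , suc (toℕ c) , s≤s z≤n ,
                         (λ x x∈ → s≤s (All.lookup ≤c x∈)) , (λ x x≤c → upTo-c x (≤-pred x≤c)))
             (λ (_ , k , _ , below , present) x x≤c → present x (≤-<-trans x≤c (below c c∈)))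
             (all? λ x → toℕ x ≤? toℕ c →-dec x ∈? a ∷ w)

  isVertex? : ∀ {n} → Decidable (IsVertex n m)
  isVertex? {n} u = (length u ≟ n) ×-dec isPattern? u

  IsVertex-↭ : ∀ {n} {u u′ : Word m} → u ↭ u′ → IsVertex n m u → IsVertex n m u′
  IsVertex-↭ u↭u′ (length≡n , 1≤length , k , 1≤k , below , present) =
    trans (sym (↭-length u↭u′)) length≡n , subst (1 ≤_) (↭-length u↭u′) 1≤length , k , 1≤k ,
    (λ x x∈u′ → below x (∈-resp-↭ (↭-sym u↭u′) x∈u′)) , (λ x x<k → ∈-resp-↭ u↭u′ (present x x<k))

  Arc-rotate : (u : Word m) → 0 < length u → Arc u (rotate u)
  Arc-rotate (a ∷ w) _ = a , a , w , refl , refl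

module _ {m : ℕ} where

  open import Data.List.Membership.DecPropositional (Finₚ._≟_ {suc m}) using (_∈?_)

  resetHead : Word (suc m) → Word (suc m)
  resetHead []      = []
  resetHead (_ ∷ w) = Fin.zero ∷ w

  Arc-resetHead⁺ : ∀ {u v : Word (suc m)} → Arc u v → Arc (resetHead u) v
  Arc-resetHead⁺ (_ , b , w , refl , v≡) = Fin.zero , b , w , refl , v≡

  Arc-resetHead⁻ : ∀ {u v : Word (suc m)} → Arc (resetHead u) v → Arc u v
  Arc-resetHead⁻ {u = a ∷ _} (_ , b , w , refl , v≡) = a , b , w , refl , v≡

  IsPattern-resetMax : ∀ {c : Fin (suc m)} {w : Word (suc m)} → IsPattern (c ∷ w) → All (Fin._≤ c) w →
                       IsPattern (Fin.zero ∷ w)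
  IsPattern-resetMax {c} {w} (_ , k , 1≤k , below , present) w≤c with c ∈? Fin.zero ∷ w
  ... | yes c∈ = s≤s z≤n , k , 1≤k , below′ , present′
    where
    below′ : ∀ x → x ∈ Fin.zero ∷ w → toℕ x < k
    below′ x (here refl)  = 1≤k
    below′ x (there x∈w) = below x (there x∈w)
    present′ : ∀ x → toℕ x < k → x ∈ Fin.zero ∷ w
    present′ x x<k with present x x<k
    ... | here refl  = c∈
    ... | there x∈w = there x∈w
  ... | no c∉ = s≤s z≤n , toℕ c , 1≤c , below′ , present′
    where
    1≤c : 1 ≤ toℕ c
    1≤c = ≤∧≢⇒< z≤n λ 0≡c → c∉ (here (toℕ-injective (sym 0≡c)))
    below′ : ∀ x → x ∈ Fin.zero ∷ w → toℕ x < toℕ c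
    below′ x (here refl)  = 1≤c
    below′ x (there x∈w) =
      ≤∧≢⇒< (All.lookup w≤c x∈w) λ x≡c → c∉ (there (subst (_∈ w) (toℕ-injective x≡c) x∈w))
    present′ : ∀ x → toℕ x < toℕ c → x ∈ Fin.zero ∷ w
    present′ x x<c with present x (<-trans x<c (below c (here refl)))
    ... | here x≡c  = contradiction (cong toℕ x≡c) (<⇒≢ x<c)
    ... | there x∈w = there x∈w

  resetMax-weight : ∀ {c : Fin (suc m)} {w : Word (suc m)} {t} → All (Fin._≤ c) w → toℕ c + weight w ≡ suc t →
                    weight (Fin.zero ∷ w) ≤ t
  resetMax-weight {c} {w} w≤c weight≡ with toℕ c
  ... | suc c′ = subst (weight w ≤_) (suc-injective weight≡) (m≤n+m (weight w) c′)
  ... | zero   = contradiction (≤-trans (subst (_≤ length w * 0) weight≡ (weight-bound w≤c))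
                                        (≤-reflexive (*-zeroʳ (length w)))) λ ()

  descent : ∀ {n} {v : Word (suc m)} {t} → IsVertex n (suc m) v → weight v ≡ suc t →
            ∃ λ i → i < n × IsVertex n (suc m) (resetHead (iterate rotate v i))
                          × weight (resetHead (iterate rotate v i)) ≤ t
  descent {v = []}    (_ , () , _)
  descent {n} {a ∷ w} {t} V@(length≡n , _) v-weight
    with c , c∈v , v≤c ← maximal-letter a w
    with i , i<length , w′ , rotated ← rotate-to-head c∈v =
    i , subst (i <_) length≡n i<length ,
    subst (λ r → IsVertex n (suc m) (resetHead r) × weight (resetHead r) ≤ t) (sym rotated)
      (reset-vertex , resetMax-weight (All.tail r≤c) (trans (weight-↭ r↭v) v-weight))
    where
    r↭v : c ∷ w′ ↭ a ∷ w
    r↭v = subst (_↭ a ∷ w) rotated (iterate-rotate-↭ i (a ∷ w))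
    r≤c : All (Fin._≤ c) (c ∷ w′)
    r≤c = All-resp-↭ (↭-sym r↭v) v≤c
    reset-vertex : IsVertex n (suc m) (Fin.zero ∷ w′)
    reset-vertex with r-length , r-pattern ← IsVertex-↭ (↭-sym r↭v) V =
      r-length , IsPattern-resetMax r-pattern (All.tail r≤c)

  weight≡0⇒replicate : (v : Word (suc m)) → weight v ≡ 0 → v ≡ List.replicate (length v) Fin.zero
  weight≡0⇒replicate []             _  = refl
  weight≡0⇒replicate (Fin.zero ∷ v) eq = cong (Fin.zero ∷_) (weight≡0⇒replicate v eq)

  replicate-zero-vertex : ∀ n → IsVertex (suc n) (suc m) (List.replicate (suc n) Fin.zero)
  replicate-zero-vertex n =
    length-replicate (suc n) , s≤s z≤n , 1 , s≤s z≤n ,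
    (λ x → All.lookup (Allₚ.replicate⁺ {P = λ y → toℕ y < 1} (suc n) (s≤s z≤n))) ,
    λ { Fin.zero _ → here refl ; (Fin.suc _) (s≤s ()) }

words : ∀ {m} → ℕ → List (Word m)
words zero        = [ [] ]
words {m} (suc k) = cartesianProductWith _∷_ (allFin m) (words k)

∈-words : ∀ {m k} (u : Word m) → length u ≡ k → u ∈ words k
∈-words []      refl = here refl
∈-words (a ∷ u) refl = ∈-cartesianProductWith⁺ _∷_ (∈-allFin a) (∈-words u refl)

record Circuit (n m : ℕ) : Set where
  field
    vertices        : List (Word m)
    closed          : Closed {E = Arc} vertices
    unique          : Unique vertices
    all-vertices    : All (IsVertex n m) vertices
    rotation-closed : ∀ {u} → u ∈ vertices → rotate u ∈ vertices

open Circuit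

module _ {n m : ℕ} where

  disjoint-rotating-to : ∀ {v xs} (C : Circuit n m) → v ∉ vertices C →
                         (∀ {u} → u ∈ xs → ∃ λ j → iterate rotate u j ≡ v) → Disjoint (vertices C) xs
  disjoint-rotating-to C v∉C rotates-to-v (u∈C , u∈xs) with j , refl ← rotates-to-v u∈xs =
    v∉C (iterate-closed rotate (rotation-closed C) j u∈C)

  merge : ∀ {u u′} (C D : Circuit n m) → Disjoint (vertices C) (vertices D) →
          u ∈ vertices C → u′ ∈ vertices D → (∀ {v} → Arc u v → Arc u′ v) → (∀ {v} → Arc u′ v → Arc u v) →
          Σ (Circuit n m) λ C′ → vertices C′ ↭ vertices C ++ vertices D
  merge C D disjoint u∈C u′∈D to from
    with ys , ys-closed , ys↭ ← Closed-merge to from u∈C u′∈D (closed C) (closed D) =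
    record
      { vertices        = ys
      ; closed          = ys-closed
      ; unique          = Permutationₛ.Unique-resp-↭ (setoid _) (↭⇒↭ₛ (↭-sym ys↭))
                            (Uniqueₚ.++⁺ (unique C) (unique D) disjoint)
      ; all-vertices    = All-resp-↭ (↭-sym ys↭) (Allₚ.++⁺ (all-vertices C) (all-vertices D))
      ; rotation-closed = λ u∈ys → ∈-resp-↭ (↭-sym ys↭) (rotation-closed-++ (∈-resp-↭ ys↭ u∈ys))
      } , ys↭
    where
    rotation-closed-++ : ∀ {u} → u ∈ vertices C ++ vertices D → rotate u ∈ vertices C ++ vertices D
    rotation-closed-++ u∈ with ∈-++⁻ (vertices C) u∈
    ... | inj₁ u∈C = ∈-++⁺ˡ (rotation-closed C u∈C)
    ... | inj₂ u∈D = ∈-++⁺ʳ (vertices C) (rotation-closed D u∈D)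

  necklace : ∀ {v} → IsVertex (suc n) m v →
             Σ (Circuit (suc n) m) λ D → v ∈ vertices D ×
               (∀ {u} → u ∈ vertices D → ∃ λ j → iterate rotate u j ≡ v)
  necklace {v} V@(length≡ , _)
    with p , returns , minimal ← least-witness (λ j → ≡-dec Finₚ._≟_ (iterate rotate v (suc j)) v) {n}
                                   (subst (λ k → iterate rotate v k ≡ v) length≡ (iterate-rotate-length v)) =
    record
      { vertices        = orbit
      ; closed          = orbit-Closed λ i → Arc-rotate _ (subst (0 <_) (sym (rotated-length i)) (s≤s z≤n))
      ; unique          = orbit-unique rotate-injective minimal
      ; all-vertices    = Allₚ.applyUpTo⁺₂ _ (suc p) λ i → IsVertex-↭ (↭-sym (iterate-rotate-↭ i v)) V
      ; rotation-closed = orbit-closed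
      } , here refl , orbit-returns
    where
    open Orbit rotate v p returns
    rotated-length : ∀ i → length (iterate rotate v i) ≡ suc n
    rotated-length i = trans (↭-length (iterate-rotate-↭ i v)) length≡

module _ {n m : ℕ} where

  open import Data.List.Membership.DecPropositional (≡-dec (Finₚ._≟_ {suc m})) using (_∈?_)

  HasParentIn : Circuit (suc n) (suc m) → Word (suc m) → Set
  HasParentIn C v = ∃ λ i → i < suc n × resetHead (iterate rotate v i) ∈ vertices C

  insertNecklace : (C : Circuit (suc n) (suc m)) (v : Word (suc m)) →
                   Σ (Circuit (suc n) (suc m)) λ C′ → vertices C ⊆ vertices C′ ×
                     (IsVertex (suc n) (suc m) v → HasParentIn C v → v ∈ vertices C′)
  insertNecklace C v with v ∈? vertices C
  ... | yes v∈C = C , id , λ _ _ → v∈C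
  ... | no v∉C with isVertex? v ×-dec anyUpTo? (λ i → resetHead (iterate rotate v i) ∈? vertices C) (suc n)
  ...   | no ¬insertable = C , id , λ V parent → contradiction (V , parent) ¬insertable
  ...   | yes (V , i , _ , parent∈C)
    with D , v∈D , returns ← necklace V
    with C′ , C′↭ ← merge C D (disjoint-rotating-to C v∉C returns) parent∈C
                          (iterate-closed rotate (rotation-closed D) i v∈D) Arc-resetHead⁻ Arc-resetHead⁺ =
    C′ , (λ u∈C → ∈-resp-↭ (↭-sym C′↭) (∈-++⁺ˡ u∈C)) , λ _ _ → ∈-resp-↭ (↭-sym C′↭) (∈-++⁺ʳ (vertices C) v∈D)

  insertNecklaces : (C : Circuit (suc n) (suc m)) (vs : List (Word (suc m))) →
                    Σ (Circuit (suc n) (suc m)) λ C′ → vertices C ⊆ vertices C′ ×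
                      (∀ {v} → v ∈ vs → IsVertex (suc n) (suc m) v → HasParentIn C v → v ∈ vertices C′)
  insertNecklaces C []       = C , id , λ ()
  insertNecklaces C (v ∷ vs)
    with C₁ , C⊆C₁ , v-inserted ← insertNecklace C v
    with C₂ , C₁⊆C₂ , vs-inserted ← insertNecklaces C₁ vs =
    C₂ , C₁⊆C₂ ∘ C⊆C₁ , λ where
      (here refl)  V parent             → C₁⊆C₂ (v-inserted V parent)
      (there v∈vs) V (i , i<n , parent) → vs-inserted v∈vs V (i , i<n , C⊆C₁ parent)

  covering-circuit : ∀ t → Σ (Circuit (suc n) (suc m)) λ C →
                       ∀ {v} → IsVertex (suc n) (suc m) v → weight v ≤ t → v ∈ vertices C
  covering-circuit zero with D , zeros∈D , _ ← necklace (replicate-zero-vertex n) =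
    D , λ {v} (length≡ , _) weight≤0 → subst (_∈ vertices D)
      (sym (trans (weight≡0⇒replicate v (n≤0⇒n≡0 weight≤0)) (cong (λ k → List.replicate k Fin.zero) length≡)))
      zeros∈D
  covering-circuit (suc t)
    with C , covers ← covering-circuit t
    with C′ , C⊆C′ , inserted ← insertNecklaces C (words (suc n)) =
    C′ , covers′
    where
    covers′ : ∀ {v} → IsVertex (suc n) (suc m) v → weight v ≤ suc t → v ∈ vertices C′
    covers′ V weight≤1+t with m≤n⇒m<n∨m≡n weight≤1+t
    ... | inj₁ (s≤s weight≤t) = C⊆C′ (covers V weight≤t)
    ... | inj₂ weight≡1+t with i , i<n , parent-vertex , parent-weight ← descent V weight≡1+t =
      inserted (∈-words _ (proj₁ V)) V (i , i<n , covers parent-vertex parent-weight)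

circuit⇒hamiltonian : ∀ {n m} (C : Circuit n m) → (∀ u → IsVertex n m u → u ∈ vertices C) →
                      HamiltonianCircuit n m
circuit⇒hamiltonian
  record { vertices = x ∷ xs ; closed = closed ; unique = unique ; all-vertices = all-vertices } covers =
  length xs , List.lookup (x ∷ xs) , (λ i → All.lookup all-vertices (∈-lookup i)) ,
  Unique-lookup-injective unique ,
  (λ u V → let u∈ = covers u V in Any.index u∈ , sym (lookup-index u∈)) ,
  Closed-lookup-next x xs closed

theorem6 : (n m : ℕ) → 1 ≤ n → 1 ≤ m → HamiltonianCircuit n m
theorem6 (suc n) (suc m) _ _ with C , covers ← covering-circuit (suc n * m) =
  circuit⇒hamiltonian C λ u V@(length≡ , _) →
    covers V (subst (λ k → weight u ≤ k * m) length≡ (weight-bound (All.universal toℕ≤pred[n] u)))
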